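{- Let $\mathcal{V}$ be a commutative unital quantale and let $\mathcal{T}$ be a $\mathcal{V}$-theory over a monoidal signature $\Sigma$. Let $\llbracket - \rrbracket : \mathbf{Term}(\Sigma) \to \mathcal{C}$ be a model of $\mathcal{T}$, i.e.\ $\mathcal{C}$ is a $\mathcal{V}\mathbf{Rel}$-SMC and $\llbracket - \rrbracket$ is a symmetric monoidal functor satisfying every implication of $\mathcal{T}$. Then there is a unique $\mathcal{V}\mathbf{Rel}$-enriched symmetric monoidal functor $F : \mathrm{Syn}(\mathcal{T}) \to \mathcal{C}$ such that $\llbracket f \rrbracket = F([f])$ for every term $f$, where $[f]$ denotes the class of $f$ in $\mathrm{Syn}(\mathcal{T})$.
   Context: A quantale $\mathcal{V}$ is a complete lattice $(\mathcal{V},\sqsubseteq)$ with an associative binary operation $+$ preserving arbitrary suprema in each argument; we assume it is unital (has a neutral element for $+$) and commutative. A $\mathcal{V}$-relation is a set $X$ with a function $d : X\times X\to\mathcal{V}$; a morphism of $\mathcal{V}$-relations $(X,d_X)\to(Y,d_Y)$ is a function $h$ with $d_X(x,x')\sqsubseteq d_Y(h(x),h(x'))$. A $\mathcal{V}\mathbf{Rel}$-SMC is a symmetric strict monoidal category $\mathcal{C}$ with a $\mathcal{V}$-relation $d^{\mathcal{C}}$ on each hom-set such that $d^{\mathcal{C}}(f;g, f';g') \sqsupseteq d^{\mathcal{C}}(f,f') + d^{\mathcal{C}}(g,g')$ and $d^{\mathcal{C}}(f\otimes g, f'\otimes g') \sqsupseteq d^{\mathcal{C}}(f,f') + d^{\mathcal{C}}(g,g')$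 whenever defined. An enriched functor $F$ between such categories is a functor with $d(f,g)\sqsubseteq d(Ff,Fg)$ on each hom-set. A monoidal signature $\Sigma$ consists of a set of sorts and a set of generators, each with a list of input sorts and a list of output sorts. $\mathbf{Term}(\Sigma)$ is the free symmetric strict monoidal category on $\Sigma$: objects are lists of sorts, morphisms $u\to v$ are terms built from generators, identities, symmetries, the identity on the empty list, sequential composition $f;g$ and parallel composition $f\otimes g$, identified modulo the laws of symmetric strict monoidal categories (string diagrams). An equation is $f=g$ and a $\mathcal{V}$-equation is $f=_\varepsilon g$ ($\varepsilon\in\mathcal{V}$), for terms $f,g$ of the same type. A $\mathcal{V}$-implication $\Gamma\Rightarrow\phi$ consists of a set $\Gamma$ of (quantitative) equations (premises) and a (quantitative) equation $\phi$ (conclusion). A $\mathcal{V}$-theory $\mathcal{T}$ is a signature with a set of $\mathcal{V}$-implications (axioms). Given a symmetric monoidal functor $\llbracket-\rrbracket:\mathbf{Term}(\Sigma)\to\mathcal{C}$ into a $\mathcal{V}\mathbf{Rel}$-SMC: $f=g$ is satisfied if $\llbracket f\rrbracket=\llbracket g\rrbracket$; $f=_\varepsilon g$ is satisfied if $d^{\mathcal{C}}(\llbracket f\rrbracket,\llbracket g\rrbracket)\sqsupseteq\varepsilon$; $\Gamma\Rightarrow\phi$ is satisfied if $\phi$ is satisfied or some premise in $\Gamma$ is not. The closure $\vdash^{\mathcal{T}}$ is the smallest consequence relation (i.e.\ set of implications $\Gamma\vdash\phi$ closed under: $\phi\in\Gamma$ implies $\Gamma\vdash\phi$; weakening of premises;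 and cut: if $\Gamma\vdash\psi$ for all $\psi\in\Delta$ and $\Delta\cup\Delta'\vdash\chi$ then $\Gamma\cup\Delta'\vdash\chi$) containing the axioms of $\mathcal{T}$ and the following implications for all terms and elements of $\mathcal{V}$: $f=_\varepsilon g\Rightarrow f=_{\varepsilon'} g$ when $\varepsilon\sqsupseteq\varepsilon'$; $\{f=_{\varepsilon_i}g\}_{i\in I}\Rightarrow f=_{\bigsqcup_i\varepsilon_i}g$; $f=_\varepsilon f', g=_\delta g' \Rightarrow f;g=_{\varepsilon+\delta} f';g'$ and $\Rightarrow f\otimes g=_{\varepsilon+\delta}f'\otimes g'$; reflexivity, symmetry, transitivity of $=$, congruence of $=$ with respect to $;$ and $\otimes$, and $f=f', f=_\varepsilon g\Rightarrow f'=_\varepsilon g$, $g=g', f=_\varepsilon g\Rightarrow f=_\varepsilon g'$; and the laws of symmetric strict monoidal categories as premise-free equations. The syntactic category $\mathrm{Syn}(\mathcal{T})$ has lists of sorts as objects, terms modulo $f\equiv g \iff \emptyset\vdash^{\mathcal{T}} f=g$ as morphisms, and the $\mathcal{V}$-relation $d^{\mathcal{T}}(f,g)=\bigsqcup\{\varepsilon\mid \emptyset\vdash^{\mathcal{T}} f=_\varepsilon g\}$ on hom-sets. -}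

module Defs where

open import Level using (Level; 0ℓ; _⊔_; Setω) renaming (suc to lsuc)
open import Data.List using (List; []; _∷_; _++_)
open import Data.List.Properties using (++-assoc; ++-identityʳ)
open import Data.Product using (Σ; ∃; _×_; _,_)
open import Relation.Binary.PropositionalEquality using (_≡_; refl; sym; subst₂)
open import Relation.Unary using (Pred; _⊆_; _∪_; ∅; ｛_｝)

record Quantale : Setω where
  infix 4 _⊑_
  infixl 6 _+_
  field
    Carrier   : Set
    _⊑_       : Carrier → Carrier → Set
    ⊑-refl    : ∀ {x} → x ⊑ x
    ⊑-trans   : ∀ {x y z} → x ⊑ y → y ⊑ z → x ⊑ z
    ⊑-antisym : ∀ {x y} → x ⊑ y → y ⊑ x → x ≡ y
    ⨆         : ∀ {ℓ} → Pred Carrier ℓ → Carrier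
    ⨆-upper   : ∀ {ℓ} (S : Pred Carrier ℓ) {x} → S x → x ⊑ ⨆ S
    ⨆-least   : ∀ {ℓ} (S : Pred Carrier ℓ) {y} → (∀ {x} → S x → x ⊑ y) → ⨆ S ⊑ y
    _+_       : Carrier → Carrier → Carrier
    unit      : Carrier
    +-assoc   : ∀ x y z → (x + y) + z ≡ x + (y + z)
    +-comm    : ∀ x y → x + y ≡ y + x
    +-unitˡ   : ∀ x → unit + x ≡ x
    +-unitʳ   : ∀ x → x + unit ≡ x
    +-⨆ˡ      : ∀ {ℓ} x (S : Pred Carrier ℓ) →
                x + ⨆ S ≡ ⨆ (λ z → ∃ λ s → S s × z ≡ x + s)
    +-⨆ʳ      : ∀ {ℓ} (S : Pred Carrier ℓ) x →
                ⨆ S + x ≡ ⨆ (λ z → ∃ λ s → S s × z ≡ s + x)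

  ⨆ᶠ : {I : Set} → (I → Carrier) → Carrier
  ⨆ᶠ {I} ε = ⨆ (λ x → ∃ λ (i : I) → ε i ≡ x)

record Signature : Set₁ where
  field
    Sort : Set
    Gen  : Set
    dom  : Gen → List Sort
    cod  : Gen → List Sort

module _ (Sg : Signature) where
  open Signature Sg

  infixl 5 _⨾_
  infixl 6 _⊗_

  data Term : List Sort → List Sort → Set where
    gen  : (g : Gen) → Term (dom g) (cod g)
    id   : (u : List Sort) → Term u u
    σ    : (u v : List Sort) → Term (u ++ v) (v ++ u)
    _⨾_  : ∀ {u v w} → Term u v → Term v w → Term u w
    _⊗_  : ∀ {u v u' v'} → Term u v → Term u' v' → Term (u ++ u') (v ++ v')

  cast : ∀ {u u' v v'} → u ≡ u' → v ≡ v' → Term u v → Term u' v'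
  cast p q t = subst₂ Term p q t

  data SMCLaw : ∀ {u v} → Term u v → Term u v → Set where
    ⨾-assoc  : ∀ {u v w x} {f : Term u v} {g : Term v w} {h : Term w x} →
               SMCLaw ((f ⨾ g) ⨾ h) (f ⨾ (g ⨾ h))
    ⨾-idˡ    : ∀ {u v} {f : Term u v} → SMCLaw (id u ⨾ f) f
    ⨾-idʳ    : ∀ {u v} {f : Term u v} → SMCLaw (f ⨾ id v) f
    ⊗-assoc  : ∀ {u v u' v' u'' v''} {f : Term u v} {g : Term u' v'} {h : Term u'' v''} →
               SMCLaw (cast (++-assoc u u' u'') (++-assoc v v' v'') ((f ⊗ g) ⊗ h))
                      (f ⊗ (g ⊗ h))
    ⊗-unitˡ  : ∀ {u v} {f : Term u v} → SMCLaw (id [] ⊗ f) f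
    ⊗-unitʳ  : ∀ {u v} {f : Term u v} →
               SMCLaw (cast (++-identityʳ u) (++-identityʳ v) (f ⊗ id [])) f
    ⊗-id     : ∀ {u v} → SMCLaw (id u ⊗ id v) (id (u ++ v))
    interchange : ∀ {u v w u' v' w'} {f : Term u v} {g : Term v w}
                    {f' : Term u' v'} {g' : Term v' w'} →
               SMCLaw ((f ⨾ g) ⊗ (f' ⨾ g')) ((f ⊗ f') ⨾ (g ⊗ g'))
    σ-inv    : ∀ {u v} → SMCLaw (σ u v ⨾ σ v u) (id (u ++ v))
    σ-nat    : ∀ {u v u' v'} {f : Term u v} {g : Term u' v'} →
               SMCLaw ((f ⊗ g) ⨾ σ v v') (σ u u' ⨾ (g ⊗ f))
    hexagon  : ∀ {u v w} →
               SMCLaw (σ u (v ++ w))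
                      (cast (++-assoc u v w) (sym (++-assoc v w u))
                        ((σ u v ⊗ id w) ⨾ cast (sym (++-assoc v u w)) refl (id v ⊗ σ u w)))

  -- congruence generated by the SMC laws: Term(Σ) is Term modulo ≈ₛ
  data _≈ₛ_ : ∀ {u v} → Term u v → Term u v → Set where
    law    : ∀ {u v} {f g : Term u v} → SMCLaw f g → f ≈ₛ g
    ≈-refl  : ∀ {u v} {f : Term u v} → f ≈ₛ f
    ≈-sym   : ∀ {u v} {f g : Term u v} → f ≈ₛ g → g ≈ₛ f
    ≈-trans : ∀ {u v} {f g h : Term u v} → f ≈ₛ g → g ≈ₛ h → f ≈ₛ h
    ≈-⨾     : ∀ {u v w} {f f' : Term u v} {g g' : Term v w} →
              f ≈ₛ f' → g ≈ₛ g' → (f ⨾ g) ≈ₛ (f' ⨾ g')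
    ≈-⊗     : ∀ {u v u' v'} {f f' : Term u v} {g g' : Term u' v'} →
              f ≈ₛ f' → g ≈ₛ g' → (f ⊗ g) ≈ₛ (f' ⊗ g')

module _ (V : Quantale) (Sg : Signature) where
  open Quantale V
  open Signature Sg

  infix 4 _≐_ _≐[_]_

  data Formula : Set where
    _≐_    : ∀ {u v} → Term Sg u v → Term Sg u v → Formula
    _≐[_]_ : ∀ {u v} → Term Sg u v → Carrier → Term Sg u v → Formula

  record Theory : Set₁ where
    field
      Ax    : Set
      prem  : Ax → Pred Formula 0ℓ
      concl : Ax → Formula

module _ {V : Quantale} {Sg : Signature} (T : Theory V Sg) where
  open Quantale V
  open Signature Sg
  open Theory T

  data Rule : Pred (Formula V Sg) 0ℓ → Formula V Sg → Set₁ where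
    axiom   : (a : Ax) → Rule (prem a) (concl a)
    q-mono  : ∀ {u v} {f g : Term Sg u v} {ε ε'} → ε' ⊑ ε →
              Rule ｛ f ≐[ ε ] g ｝ (f ≐[ ε' ] g)
    q-sup   : ∀ {u v} {f g : Term Sg u v} (I : Set) (ε : I → Carrier) →
              Rule (λ ψ → ∃ λ i → ψ ≡ (f ≐[ ε i ] g)) (f ≐[ ⨆ᶠ ε ] g)
    q-⨾     : ∀ {u v w} {f f' : Term Sg u v} {g g' : Term Sg v w} {ε δ} →
              Rule (｛ f ≐[ ε ] f' ｝ ∪ ｛ g ≐[ δ ] g' ｝) ((f ⨾ g) ≐[ ε + δ ] (f' ⨾ g'))
    q-⊗     : ∀ {u v u' v'} {f f' : Term Sg u v} {g g' : Term Sg u' v'} {ε δ} →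
              Rule (｛ f ≐[ ε ] f' ｝ ∪ ｛ g ≐[ δ ] g' ｝) ((f ⊗ g) ≐[ ε + δ ] (f' ⊗ g'))
    e-refl  : ∀ {u v} {f : Term Sg u v} → Rule ∅ (f ≐ f)
    e-sym   : ∀ {u v} {f g : Term Sg u v} → Rule ｛ f ≐ g ｝ (g ≐ f)
    e-trans : ∀ {u v} {f g h : Term Sg u v} → Rule (｛ f ≐ g ｝ ∪ ｛ g ≐ h ｝) (f ≐ h)
    e-⨾     : ∀ {u v w} {f f' : Term Sg u v} {g g' : Term Sg v w} →
              Rule (｛ f ≐ f' ｝ ∪ ｛ g ≐ g' ｝) ((f ⨾ g) ≐ (f' ⨾ g'))
    e-⊗     : ∀ {u v u' v'} {f f' : Term Sg u v} {g g' : Term Sg u' v'} →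
              Rule (｛ f ≐ f' ｝ ∪ ｛ g ≐ g' ｝) ((f ⊗ g) ≐ (f' ⊗ g'))
    e-substˡ : ∀ {u v} {f f' g : Term Sg u v} {ε} →
              Rule (｛ f ≐ f' ｝ ∪ ｛ f ≐[ ε ] g ｝) (f' ≐[ ε ] g)
    e-substʳ : ∀ {u v} {f g g' : Term Sg u v} {ε} →
              Rule (｛ g ≐ g' ｝ ∪ ｛ f ≐[ ε ] g ｝) (f ≐[ ε ] g')
    smc     : ∀ {u v} {f g : Term Sg u v} → SMCLaw Sg f g → Rule ∅ (f ≐ g)

  infix 3 _⊢_
  data _⊢_ : Pred (Formula V Sg) 0ℓ → Formula V Sg → Set₁ where
    assum  : ∀ {Γ φ} → Γ φ → Γ ⊢ φ
    weaken : ∀ {Γ Γ' φ} → Γ ⊆ Γ' → Γ ⊢ φ → Γ' ⊢ φ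
    cut    : ∀ {Γ Δ Δ' χ} → (∀ {ψ} → Δ ψ → Γ ⊢ ψ) → (Δ ∪ Δ') ⊢ χ → (Γ ∪ Δ') ⊢ χ
    rule   : ∀ {Δ φ} → Rule Δ φ → Δ ⊢ φ

  -- Syn(T): hom-sets are terms modulo ≡ᵀ, with V-relation dᵀ
  _≡ᵀ_ : ∀ {u v} → Term Sg u v → Term Sg u v → Set₁
  f ≡ᵀ g = ∅ ⊢ (f ≐ g)

  dᵀ : ∀ {u v} → Term Sg u v → Term Sg u v → Carrier
  dᵀ f g = ⨆ (λ ε → ∅ ⊢ (f ≐[ ε ] g))

record VRelSMC (V : Quantale) : Set₁ where
  open Quantale V
  infixl 5 _⨾ᶜ_
  infixl 6 _⊗₀_ _⊗₁_
  field
    Obj   : Set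
    Hom   : Obj → Obj → Set
    idC   : (a : Obj) → Hom a a
    _⨾ᶜ_   : ∀ {a b c} → Hom a b → Hom b c → Hom a c
    ⨾-assocᶜ : ∀ {a b c e} (f : Hom a b) (g : Hom b c) (h : Hom c e) →
              (f ⨾ᶜ g) ⨾ᶜ h ≡ f ⨾ᶜ (g ⨾ᶜ h)
    ⨾-idˡᶜ : ∀ {a b} (f : Hom a b) → idC a ⨾ᶜ f ≡ f
    ⨾-idʳᶜ : ∀ {a b} (f : Hom a b) → f ⨾ᶜ idC b ≡ f
    𝕀     : Obj
    _⊗₀_  : Obj → Obj → Obj
    _⊗₁_  : ∀ {a b a' b'} → Hom a b → Hom a' b' → Hom (a ⊗₀ a') (b ⊗₀ b')
    ⊗₀-assoc : ∀ a b c → (a ⊗₀ b) ⊗₀ c ≡ a ⊗₀ (b ⊗₀ c)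
    ⊗₀-unitˡ : ∀ a → 𝕀 ⊗₀ a ≡ a
    ⊗₀-unitʳ : ∀ a → a ⊗₀ 𝕀 ≡ a
    ⊗₁-assocᶜ : ∀ {a b a' b' a'' b''} (f : Hom a b) (g : Hom a' b') (h : Hom a'' b'') →
               subst₂ Hom (⊗₀-assoc a a' a'') (⊗₀-assoc b b' b'') ((f ⊗₁ g) ⊗₁ h)
                 ≡ f ⊗₁ (g ⊗₁ h)
    ⊗₁-unitˡᶜ : ∀ {a b} (f : Hom a b) →
               subst₂ Hom (⊗₀-unitˡ a) (⊗₀-unitˡ b) (idC 𝕀 ⊗₁ f) ≡ f
    ⊗₁-unitʳᶜ : ∀ {a b} (f : Hom a b) →
               subst₂ Hom (⊗₀-unitʳ a) (⊗₀-unitʳ b) (f ⊗₁ idC 𝕀) ≡ f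
    ⊗-idᶜ     : ∀ a b → idC a ⊗₁ idC b ≡ idC (a ⊗₀ b)
    interchangeᶜ : ∀ {a b c a' b' c'} (f : Hom a b) (g : Hom b c) (f' : Hom a' b') (g' : Hom b' c') →
               (f ⨾ᶜ g) ⊗₁ (f' ⨾ᶜ g') ≡ (f ⊗₁ f') ⨾ᶜ (g ⊗₁ g')
    σC       : ∀ a b → Hom (a ⊗₀ b) (b ⊗₀ a)
    σ-invᶜ    : ∀ a b → σC a b ⨾ᶜ σC b a ≡ idC (a ⊗₀ b)
    σ-natᶜ    : ∀ {a b a' b'} (f : Hom a b) (g : Hom a' b') →
               (f ⊗₁ g) ⨾ᶜ σC b b' ≡ σC a a' ⨾ᶜ (g ⊗₁ f)
    hexagonᶜ  : ∀ a b c →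
               σC a (b ⊗₀ c) ≡
               subst₂ Hom (⊗₀-assoc a b c) (sym (⊗₀-assoc b c a))
                 ((σC a b ⊗₁ idC c) ⨾ᶜ subst₂ Hom (sym (⊗₀-assoc b a c)) refl (idC b ⊗₁ σC a c))
    d     : ∀ {a b} → Hom a b → Hom a b → Carrier
    d-⨾   : ∀ {a b c} (f f' : Hom a b) (g g' : Hom b c) →
            d f f' + d g g' ⊑ d (f ⨾ᶜ g) (f' ⨾ᶜ g')
    d-⊗   : ∀ {a b a' b'} (f f' : Hom a b) (g g' : Hom a' b') →
            d f f' + d g g' ⊑ d (f ⊗₁ g) (f' ⊗₁ g')

-- Symmetric (strict) monoidal functors out of a category of terms modulo
-- a congruence R  (R = ≈ₛ gives Term(Σ), R = ≡ᵀ gives Syn(T))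

record SMFunctor {ℓ} (V : Quantale) (Sg : Signature)
                 (R : ∀ {u v} → Term Sg u v → Term Sg u v → Set ℓ)
                 (C : VRelSMC V) : Set ℓ where
  open Signature Sg
  open VRelSMC C
  field
    F₀    : List Sort → Obj
    F₁    : ∀ {u v} → Term Sg u v → Hom (F₀ u) (F₀ v)
    F-resp : ∀ {u v} {f g : Term Sg u v} → R f g → F₁ f ≡ F₁ g
    F-id  : ∀ u → F₁ (id u) ≡ idC (F₀ u)
    F-⨾   : ∀ {u v w} (f : Term Sg u v) (g : Term Sg v w) → F₁ (f ⨾ g) ≡ F₁ f ⨾ᶜ F₁ g
    F-𝕀   : F₀ [] ≡ 𝕀
    F-⊗₀  : ∀ u v → F₀ (u ++ v) ≡ F₀ u ⊗₀ F₀ v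
    F-⊗₁  : ∀ {u v u' v'} (f : Term Sg u v) (g : Term Sg u' v') →
            subst₂ Hom (F-⊗₀ u u') (F-⊗₀ v v') (F₁ (f ⊗ g)) ≡ F₁ f ⊗₁ F₁ g
    F-σ   : ∀ u v →
            subst₂ Hom (F-⊗₀ u v) (F-⊗₀ v u) (F₁ (σ u v)) ≡ σC (F₀ u) (F₀ v)

module _ {V : Quantale} {Sg : Signature} {C : VRelSMC V} where
  open Quantale V
  open Signature Sg
  open VRelSMC C

  Interp : Set
  Interp = SMFunctor V Sg (_≈ₛ_ Sg) C

  Sat : Interp → Formula V Sg → Set
  Sat J (f ≐ g)      = SMFunctor.F₁ J f ≡ SMFunctor.F₁ J g
  Sat J (f ≐[ ε ] g) = ε ⊑ d (SMFunctor.F₁ J f) (SMFunctor.F₁ J g)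

  IsModel : Theory V Sg → Interp → Set
  IsModel T J = ∀ (a : Theory.Ax T) →
                (∀ {ψ} → Theory.prem T a ψ → Sat J ψ) → Sat J (Theory.concl T a)

  SynFunctor : Theory V Sg → Set₁
  SynFunctor T = SMFunctor V Sg (_≡ᵀ_ T) C

  Enriched : (T : Theory V Sg) → SynFunctor T → Set
  Enriched T F = ∀ {u v} (f g : Term Sg u v) →
                 dᵀ T f g ⊑ d (SMFunctor.F₁ F f) (SMFunctor.F₁ F g)

  SameOn : ∀ {ℓ ℓ'} {R : ∀ {u v} → Term Sg u v → Term Sg u v → Set ℓ}
             {R' : ∀ {u v} → Term Sg u v → Term Sg u v → Set ℓ'} →
           SMFunctor V Sg R C → SMFunctor V Sg R' C → Set
  SameOn F G =
    Σ (∀ u → SMFunctor.F₀ F u ≡ SMFunctor.F₀ G u) λ p →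
      ∀ {u v} (f : Term Sg u v) →
        subst₂ Hom (p u) (p v) (SMFunctor.F₁ F f) ≡ SMFunctor.F₁ G f

{-# OPTIONS --safe #-}
-- Every rule generating ⊢ᵀ is sound in a model ⟦-⟧ of T: the axioms because ⟦-⟧
-- satisfies them, the quantitative congruence rules because + is monotone and
-- d is superadditive along ⨾ and ⊗ in C, and the remaining ones because ⟦-⟧ is a
-- symmetric monoidal functor. Soundness survives assumption, weakening and cut,
-- so ⟦-⟧ identifies T-provably equal terms and dᵀ(f, g) ⊑ d(⟦f⟧, ⟦g⟧). Hence ⟦-⟧
-- itself is an enriched functor on Syn(T); it is unique because F([f]) = ⟦f⟧
-- already determines F on every morphism.
module Submission where

open import Defs
open import Level using (Level; 0ℓ)
open import Data.Product using (Σ; ∃; _×_; _,_)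
open import Data.Sum using (_⊎_; inj₁; inj₂)
open import Relation.Binary.PropositionalEquality
  using (_≡_; refl; sym; trans; cong; cong₂; subst; subst₂; module ≡-Reasoning)
open import Relation.Unary using (Pred; ｛_｝; _∪_)

module QuantaleProperties (V : Quantale) where
  open Quantale V

  ⊑-respʳ-≡ : ∀ {x y z} → x ⊑ y → y ≡ z → x ⊑ z
  ⊑-respʳ-≡ x⊑y refl = x⊑y

  x⊑y⇒⨆xy≡y : ∀ {x y} → x ⊑ y → ⨆ (｛ x ｝ ∪ ｛ y ｝) ≡ y
  x⊑y⇒⨆xy≡y x⊑y = ⊑-antisym
    (⨆-least _ λ { (inj₁ refl) → x⊑y ; (inj₂ refl) → ⊑-refl })
    (⨆-upper _ (inj₂ refl))

  -- x ⊑ y makes y the join of x and y, which z + _ preserves.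
  +-monoʳ-⊑ : ∀ z {x y} → x ⊑ y → z + x ⊑ z + y
  +-monoʳ-⊑ z {x} {y} x⊑y = ⊑-respʳ-≡ (⨆-upper _ (x , inj₁ refl , refl)) (begin
    ⨆ (λ w → ∃ λ s → (｛ x ｝ ∪ ｛ y ｝) s × w ≡ z + s)  ≡⟨ sym (+-⨆ˡ z (｛ x ｝ ∪ ｛ y ｝)) ⟩
    z + ⨆ (｛ x ｝ ∪ ｛ y ｝)                             ≡⟨ cong (z +_) (x⊑y⇒⨆xy≡y x⊑y) ⟩
    z + y                                              ∎)
    where open ≡-Reasoning

  +-mono-⊑ : ∀ {x y x' y'} → x ⊑ y → x' ⊑ y' → x + x' ⊑ y + y'
  +-mono-⊑ {x} {y} {x'} {y'} x⊑y x'⊑y' = ⊑-trans (+-monoʳ-⊑ x x'⊑y')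
    (subst₂ _⊑_ (+-comm y' x) (+-comm y' y) (+-monoʳ-⊑ y' x⊑y))

module VRelSMCProperties {V : Quantale} (C : VRelSMC V) where
  open VRelSMC C

  d-subst₂ : ∀ {a b a' b'} (p : a ≡ a') (q : b ≡ b') (f g : Hom a b) →
             d (subst₂ Hom p q f) (subst₂ Hom p q g) ≡ d f g
  d-subst₂ refl refl f g = refl

  subst₂-injective : ∀ {a b a' b'} (p : a ≡ a') (q : b ≡ b') {f g : Hom a b} →
                     subst₂ Hom p q f ≡ subst₂ Hom p q g → f ≡ g
  subst₂-injective refl refl f≡g = f≡g

module SMFunctorProperties {ℓ : Level} {V : Quantale} {Sg : Signature} {C : VRelSMC V}
       {R : ∀ {u v} → Term Sg u v → Term Sg u v → Set ℓ} (F : SMFunctor V Sg R C) where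
  open Quantale V
  open VRelSMC C
  open QuantaleProperties V
  open VRelSMCProperties C
  open SMFunctor F

  F₁-⨾-cong : ∀ {u v w} {f f' : Term Sg u v} {g g' : Term Sg v w} →
              F₁ f ≡ F₁ f' → F₁ g ≡ F₁ g' → F₁ (f ⨾ g) ≡ F₁ (f' ⨾ g')
  F₁-⨾-cong {f = f} {f'} {g} {g'} Ff≡Ff' Fg≡Fg' = begin
    F₁ (f ⨾ g)       ≡⟨ F-⨾ f g ⟩
    F₁ f ⨾ᶜ F₁ g     ≡⟨ cong₂ _⨾ᶜ_ Ff≡Ff' Fg≡Fg' ⟩
    F₁ f' ⨾ᶜ F₁ g'   ≡⟨ sym (F-⨾ f' g') ⟩
    F₁ (f' ⨾ g')     ∎
    where open ≡-Reasoning

  F₁-⊗-cong : ∀ {u v u' v'} {f f' : Term Sg u v} {g g' : Term Sg u' v'} →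
              F₁ f ≡ F₁ f' → F₁ g ≡ F₁ g' → F₁ (f ⊗ g) ≡ F₁ (f' ⊗ g')
  F₁-⊗-cong {u} {v} {u'} {v'} {f} {f'} {g} {g'} Ff≡Ff' Fg≡Fg' =
    subst₂-injective (F-⊗₀ u u') (F-⊗₀ v v') (begin
      subst₂ Hom (F-⊗₀ u u') (F-⊗₀ v v') (F₁ (f ⊗ g))    ≡⟨ F-⊗₁ f g ⟩
      F₁ f ⊗₁ F₁ g                                       ≡⟨ cong₂ _⊗₁_ Ff≡Ff' Fg≡Fg' ⟩
      F₁ f' ⊗₁ F₁ g'                                     ≡⟨ sym (F-⊗₁ f' g') ⟩
      subst₂ Hom (F-⊗₀ u u') (F-⊗₀ v v') (F₁ (f' ⊗ g'))  ∎)
    where open ≡-Reasoning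

  d-F₁-⨾ : ∀ {u v w} (f f' : Term Sg u v) (g g' : Term Sg v w) →
           d (F₁ f) (F₁ f') + d (F₁ g) (F₁ g') ⊑ d (F₁ (f ⨾ g)) (F₁ (f' ⨾ g'))
  d-F₁-⨾ f f' g g' =
    ⊑-respʳ-≡ (d-⨾ _ _ _ _) (sym (cong₂ d (F-⨾ f g) (F-⨾ f' g')))

  d-F₁-⊗ : ∀ {u v u' v'} (f f' : Term Sg u v) (g g' : Term Sg u' v') →
           d (F₁ f) (F₁ f') + d (F₁ g) (F₁ g') ⊑ d (F₁ (f ⊗ g)) (F₁ (f' ⊗ g'))
  d-F₁-⊗ {u} {v} {u'} {v'} f f' g g' = ⊑-respʳ-≡ (d-⊗ _ _ _ _) d⊗≡
    where
      open ≡-Reasoning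
      d⊗≡ : d (F₁ f ⊗₁ F₁ g) (F₁ f' ⊗₁ F₁ g') ≡ d (F₁ (f ⊗ g)) (F₁ (f' ⊗ g'))
      d⊗≡ = begin
        d (F₁ f ⊗₁ F₁ g) (F₁ f' ⊗₁ F₁ g')
          ≡⟨ sym (cong₂ d (F-⊗₁ f g) (F-⊗₁ f' g')) ⟩
        d (subst₂ Hom (F-⊗₀ u u') (F-⊗₀ v v') (F₁ (f ⊗ g)))
          (subst₂ Hom (F-⊗₀ u u') (F-⊗₀ v v') (F₁ (f' ⊗ g')))
          ≡⟨ d-subst₂ (F-⊗₀ u u') (F-⊗₀ v v') _ _ ⟩
        d (F₁ (f ⊗ g)) (F₁ (f' ⊗ g'))
          ∎

  requotient : ∀ {ℓ'} {R' : ∀ {u v} → Term Sg u v → Term Sg u v → Set ℓ'} →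
               (∀ {u v} {f g : Term Sg u v} → R' f g → F₁ f ≡ F₁ g) →
               SMFunctor V Sg R' C
  requotient F-resp' = record
    { F₀ = F₀ ; F₁ = F₁ ; F-resp = F-resp'
    ; F-id = F-id ; F-⨾ = F-⨾ ; F-𝕀 = F-𝕀 ; F-⊗₀ = F-⊗₀ ; F-⊗₁ = F-⊗₁ ; F-σ = F-σ }

module Soundness {V : Quantale} {Sg : Signature} (T : Theory V Sg) {C : VRelSMC V}
       (J : Interp {V} {Sg} {C}) (J⊨T : IsModel T J) where
  open Quantale V
  open VRelSMC C
  open QuantaleProperties V
  open SMFunctor J
  open SMFunctorProperties J

  SatAll : Pred (Formula V Sg) 0ℓ → Set
  SatAll Γ = ∀ {ψ} → Γ ψ → Sat J ψ

  Rule-sound : ∀ {Δ φ} → Rule T Δ φ → SatAll Δ → Sat J φ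
  Rule-sound (axiom a) J⊨Δ = J⊨T a J⊨Δ
  Rule-sound (q-mono ε'⊑ε) J⊨Δ = ⊑-trans ε'⊑ε (J⊨Δ refl)
  Rule-sound (q-sup I ε) J⊨Δ = ⨆-least _ λ { (i , refl) → J⊨Δ (i , refl) }
  Rule-sound (q-⨾ {f = f} {f'} {g} {g'}) J⊨Δ =
    ⊑-trans (+-mono-⊑ (J⊨Δ (inj₁ refl)) (J⊨Δ (inj₂ refl))) (d-F₁-⨾ f f' g g')
  Rule-sound (q-⊗ {f = f} {f'} {g} {g'}) J⊨Δ =
    ⊑-trans (+-mono-⊑ (J⊨Δ (inj₁ refl)) (J⊨Δ (inj₂ refl))) (d-F₁-⊗ f f' g g')
  Rule-sound e-refl J⊨Δ = refl
  Rule-sound e-sym J⊨Δ = sym (J⊨Δ refl)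
  Rule-sound e-trans J⊨Δ = trans (J⊨Δ (inj₁ refl)) (J⊨Δ (inj₂ refl))
  Rule-sound e-⨾ J⊨Δ = F₁-⨾-cong (J⊨Δ (inj₁ refl)) (J⊨Δ (inj₂ refl))
  Rule-sound e-⊗ J⊨Δ = F₁-⊗-cong (J⊨Δ (inj₁ refl)) (J⊨Δ (inj₂ refl))
  Rule-sound (e-substˡ {g = g} {ε}) J⊨Δ =
    subst (λ h → ε ⊑ d h (F₁ g)) (J⊨Δ (inj₁ refl)) (J⊨Δ (inj₂ refl))
  Rule-sound (e-substʳ {f = f} {ε = ε}) J⊨Δ =
    subst (λ h → ε ⊑ d (F₁ f) h) (J⊨Δ (inj₁ refl)) (J⊨Δ (inj₂ refl))
  Rule-sound (smc l) J⊨Δ = F-resp (law l)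

  ⊢-sound : ∀ {Γ φ} → _⊢_ T Γ φ → SatAll Γ → Sat J φ
  ⊢-sound (assum φ∈Γ) J⊨Γ = J⊨Γ φ∈Γ
  ⊢-sound (weaken Γ⊆Γ' Γ⊢φ) J⊨Γ' = ⊢-sound Γ⊢φ (λ ψ∈Γ → J⊨Γ' (Γ⊆Γ' ψ∈Γ))
  ⊢-sound (cut Γ⊢Δ ΔΔ'⊢χ) J⊨ΓΔ' = ⊢-sound ΔΔ'⊢χ λ
    { (inj₁ ψ∈Δ)  → ⊢-sound (Γ⊢Δ ψ∈Δ) (λ ψ∈Γ → J⊨ΓΔ' (inj₁ ψ∈Γ))
    ; (inj₂ ψ∈Δ') → J⊨ΓΔ' (inj₂ ψ∈Δ') }
  ⊢-sound (rule r) J⊨Δ = Rule-sound r J⊨Δ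

  ≡ᵀ-sound : ∀ {u v} {f g : Term Sg u v} → _≡ᵀ_ T f g → F₁ f ≡ F₁ g
  ≡ᵀ-sound ⊢f≐g = ⊢-sound ⊢f≐g (λ ())

  dᵀ-sound : ∀ {u v} (f g : Term Sg u v) → dᵀ T f g ⊑ d (F₁ f) (F₁ g)
  dᵀ-sound f g = ⨆-least _ (λ ⊢f≐[ε]g → ⊢-sound ⊢f≐[ε]g (λ ()))

lemma3p7 : (V : Quantale) (Sg : Signature) (T : Theory V Sg) (C : VRelSMC V)
           (J : Interp {V} {Sg} {C}) → IsModel T J →
           Σ (SynFunctor {C = C} T) λ F →
             Enriched T F × SameOn F J ×
             ((G : SynFunctor {C = C} T) → Enriched T G → SameOn G J → SameOn G F)
lemma3p7 V Sg T C J J⊨T =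
  J/T , dᵀ-sound , ((λ _ → refl) , (λ _ → refl)) , (λ G _ G≃J → G≃J)
  where
    open Soundness T J J⊨T
    -- J/T has the same F₀ and F₁ as J, so SameOn G J and SameOn G J/T coincide.
    J/T : SynFunctor {C = C} T
    J/T = SMFunctorProperties.requotient J ≡ᵀ-sound
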